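{- Let $d\ge 0$ be an integer and let $v_d(n)$ be the number of $d$-restricted directed column-convex polyominoes of area $n$ (with $v_d(0)=1$, counting the empty polyomino). Then $$\sum_{n\geq 0}v_d(n)x^n=\frac{1-2x+2x^2-x^{d+1}}{(1-x)(1-2x+x^2-x^{d+1})}.$$
   Context: A polyomino $P$ (a finite edge-connected set of unit cells of the square lattice) is directed if every cell $c\in P$ can be joined to the bottom-left corner cell of $P$ by a path of cells contained in $P$ using only north and east steps; it is column-convex if each of its columns is a contiguous vertical segment of cells. A directed column-convex polyomino is abbreviated dccp. The area of a polyomino is its number of cells. For a dccp with columns $1,\dots,k$ from left to right, let $a_i$ be the initial altitude (height of the bottom edge) of column $i$, measured from the bottom of the first column, so the initial-altitude vector is $A=(0,a_2,\dots,a_k)$. For an integer $d\ge 0$, a dccp is $d$-restricted if either it has exactly one or two columns, or its initial-altitude vector satisfies $a_{i+1}-a_i\ge d$ for all $2\le i\le k-1$ (the difference $a_2-a_1$ is not restricted). -}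

module Defs where

open import Data.Nat using (ℕ; zero; suc; _+_; _∸_; _≤ᵇ_; _<ᵇ_; _≡ᵇ_)
open import Data.Bool using (Bool; true; false; _∧_; _∨_; not)
open import Data.Product using (_×_; _,_)
open import Data.List using (List; []; _∷_; map; concatMap; filterᵇ; length; upTo)
open import Data.Nat.ListAction using (sum)
open import Data.Integer as ℤ using (ℤ; +_)
open import Relation.Nullary.Decidable using (⌊_⌋)

-- A column-convex polyomino with k columns is encoded by the list of its
-- columns from left to right; column i is the pair (a_i , h_i) where a_i
-- is its initial altitude (height of its bottom edge, measured from the
-- bottom of the first column) and h_i ≥ 1 its number of cells.  So column
-- i consists of the cells (i , y) with a_i ≤ y < a_i + h_i.

Column : Set
Column = ℕ × ℕ

area : List Column → ℕ
area cs = sum (map (λ { (a , h) → h }) cs)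

-- Consecutive columns (a , h), (a' , h') of a directed column-convex
-- polyomino: edge-connected (a' < a + h) and directed (a ≤ a').
-- These are exactly the conditions for every cell to be reachable from
-- the bottom-left cell by north/east steps inside the polyomino.
stepOK : Column → List Column → Bool
stepOK _ [] = true
stepOK (a , h) ((a' , h') ∷ cs) =
  (a ≤ᵇ a') ∧ (a' <ᵇ a + h) ∧ (1 ≤ᵇ h') ∧ stepOK (a' , h') cs

isDCCP : List Column → Bool
isDCCP [] = true
isDCCP ((a , h) ∷ cs) = (a ≡ᵇ 0) ∧ (1 ≤ᵇ h) ∧ stepOK (a , h) cs

gapsAtLeast : ℕ → List Column → Bool
gapsAtLeast d [] = true
gapsAtLeast d ((a , _) ∷ []) = true
gapsAtLeast d ((a , _) ∷ ((a' , h') ∷ cs)) =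
  (a + d ≤ᵇ a') ∧ gapsAtLeast d ((a' , h') ∷ cs)

-- d-restricted: at most two columns, or a_{i+1} - a_i ≥ d for 2 ≤ i ≤ k-1
-- (the difference a_2 - a_1 is unrestricted).
isRestricted : ℕ → List Column → Bool
isRestricted d [] = true
isRestricted d (_ ∷ cs) = gapsAtLeast d cs

-- A dccp of area n has at most n columns, every height ≤ n and every
-- initial altitude < n, so all of them occur (each exactly once) among
-- the lists of length ≤ n with entries in {0..n} × {0..n}.

entries : ℕ → List Column
entries n = concatMap (λ a → map (λ h → (a , h)) (upTo (suc n))) (upTo (suc n))

listsOfLength : List Column → ℕ → List (List Column)
listsOfLength L zero = [] ∷ []
listsOfLength L (suc k) = concatMap (λ x → map (x ∷_) (listsOfLength L k)) L

candidates : ℕ → List (List Column)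
candidates n = concatMap (listsOfLength (entries n)) (upTo (suc n))

v : ℕ → ℕ → ℕ
v d n = length (filterᵇ (λ cs → isDCCP cs ∧ isRestricted d cs ∧ (area cs ≡ᵇ n))
                        (candidates n))

Series : Set
Series = ℕ → ℤ

sumTo : ℕ → (ℕ → ℤ) → ℤ
sumTo zero f = f 0
sumTo (suc n) f = sumTo n f ℤ.+ f (suc n)

_⊛_ : Series → Series → Series
(f ⊛ g) n = sumTo n (λ i → f i ℤ.* g (n ∸ i))

_⊕_ : Series → Series → Series
(f ⊕ g) n = f n ℤ.+ g n

mono : ℤ → ℕ → Series
mono c k n with k ≡ᵇ n
... | true = c
... | false = + 0

numer : ℕ → Series
numer d = mono (+ 1) 0 ⊕ (mono (ℤ.- + 2) 1 ⊕ (mono (+ 2) 2 ⊕ mono (ℤ.- + 1) (suc d)))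

denom : ℕ → Series
denom d = (mono (+ 1) 0 ⊕ mono (ℤ.- + 1) 1)
        ⊛ (mono (+ 1) 0 ⊕ (mono (ℤ.- + 2) 1 ⊕ (mono (+ 1) 2 ⊕ mono (ℤ.- + 1) (suc d))))

genfun : ℕ → Series
genfun d n = + (v d n)

-- Read a d-restricted dccp column by column.  After a column of height h the next column has
-- h admissible altitudes if it is the second column and h ∸ d otherwise, whatever follows it.
-- So if s(m) counts the nonempty dccps of area m in which every gap a_{i+1} - a_i, a₂ - a₁ included,
-- is at least d, and W(n) = Σ_{1≤h≤n} h · s(n - h), then for n, m ≥ 1
--   v(n) = 1 + W(n)   and   s(m) = 1 + Σ_{1≤h≤m} (h ∸ d) · s(m - h) = 1 + W(m ∸ d).
-- The second difference of W is s, whence v(m+2) - 2 v(m+1) + v(m) = v(m+1 ∸ d).  In series form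
-- (1 - 2x + x² - x^{d+1}) V has coefficients Σ_{i ≤ n} numer_i, and multiplying by 1 - x gives numer.

module Submission where

open import Defs
open import Relation.Binary.PropositionalEquality using (_≡_; module ≡-Reasoning)
open import Data.Nat using (ℕ)

module Enumeration where

  open import Data.Bool using (Bool; true; false; _∧_; T)
  open import Data.Bool.Properties using (∧-commutativeMonoid; ∧-identityʳ; ∧-zeroʳ; T-≡; T-∧)
  open import Data.Nat
  open import Data.Nat.Properties
  open import Algebra.Properties.CommutativeSemigroup +-commutativeSemigroup using (interchange)
  open import Data.Nat.ListAction using (sum)
  open import Data.Nat.Tactic.RingSolver using (solve-∀)
  open import Data.Nat.ListAction.Properties using (sum-++)
  open import Data.List using (List; []; _∷_; _++_; map; concatMap; filterᵇ; length; upTo; applyUpTo)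
  open import Data.List.Properties using (map-++; map-∘)
  open import Data.Product using (_,_; proj₁; proj₂)
  open import Algebra.Solver.CommutativeMonoid ∧-commutativeMonoid using (solve; _⊜_) renaming (_⊕_ to _∧′_)
  open import Function using (_∘_; id; const; Equivalence)
  open import Relation.Nullary using (contradiction)
  open import Relation.Nullary.Reflects using (ofʸ; ofⁿ)
  open import Relation.Binary.PropositionalEquality
  open ≡-Reasoning

  𝟙 : Bool → ℕ
  𝟙 true  = 1
  𝟙 false = 0

  𝟙-∧ : ∀ b c → 𝟙 (b ∧ c) ≡ 𝟙 b * 𝟙 c
  𝟙-∧ true  c = sym (+-identityʳ (𝟙 c))
  𝟙-∧ false c = refl

  𝟙-∧-* : ∀ b c x → 𝟙 (b ∧ c) * x ≡ 𝟙 b * (𝟙 c * x)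
  𝟙-∧-* b c x = trans (cong (_* x) (𝟙-∧ b c)) (*-assoc (𝟙 b) (𝟙 c) x)

  𝟙-*-cong : ∀ b {x y} → (T b → x ≡ y) → 𝟙 b * x ≡ 𝟙 b * y
  𝟙-*-cong true  x≡y = cong (1 *_) (x≡y _)
  𝟙-*-cong false _   = refl

  T⇒≡true : ∀ {b} → T b → b ≡ true
  T⇒≡true = Equivalence.to T-≡

  ≥⇒<ᵇ≡false : ∀ {m n} → n ≤ m → (m <ᵇ n) ≡ false
  ≥⇒<ᵇ≡false {m} {n} n≤m with m <ᵇ n | <ᵇ-reflects-< m n
  ... | false | _      = refl
  ... | true  | ofʸ m<n = contradiction n≤m (<⇒≱ m<n)

  ∑< : ℕ → (ℕ → ℕ) → ℕ
  ∑< zero    f = 0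
  ∑< (suc n) f = ∑< n f + f n

  syntax ∑< n (λ i → e) = ∑[ i < n ] e

  ∑<-cong : ∀ n {f g : ℕ → ℕ} → (∀ {i} → i < n → f i ≡ g i) → ∑< n f ≡ ∑< n g
  ∑<-cong zero    f≡g = refl
  ∑<-cong (suc n) f≡g = cong₂ _+_ (∑<-cong n (f≡g ∘ m<n⇒m<1+n)) (f≡g ≤-refl)

  ∑<-zero : ∀ n {f : ℕ → ℕ} → (∀ {i} → i < n → f i ≡ 0) → ∑< n f ≡ 0
  ∑<-zero zero    f≡0 = refl
  ∑<-zero (suc n) f≡0 = cong₂ _+_ (∑<-zero n (f≡0 ∘ m<n⇒m<1+n)) (f≡0 ≤-refl)

  ∑<-+ : ∀ n (f g : ℕ → ℕ) → ∑[ i < n ] (f i + g i) ≡ ∑< n f + ∑< n g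
  ∑<-+ zero    f g = refl
  ∑<-+ (suc n) f g = trans (cong (_+ (f n + g n)) (∑<-+ n f g)) (interchange (∑< n f) (∑< n g) (f n) (g n))

  ∑<-*ˡ : ∀ n c (f : ℕ → ℕ) → ∑[ i < n ] (c * f i) ≡ c * ∑< n f
  ∑<-*ˡ zero    c f = sym (*-zeroʳ c)
  ∑<-*ˡ (suc n) c f = trans (cong (_+ c * f n) (∑<-*ˡ n c f)) (sym (*-distribˡ-+ c (∑< n f) (f n)))

  ∑<-*ʳ : ∀ n c (f : ℕ → ℕ) → ∑[ i < n ] (f i * c) ≡ ∑< n f * c
  ∑<-*ʳ zero    c f = refl
  ∑<-*ʳ (suc n) c f = trans (cong (_+ f n * c) (∑<-*ʳ n c f)) (sym (*-distribʳ-+ c (∑< n f) (f n)))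

  ∑<-first : ∀ n (f : ℕ → ℕ) → ∑< (suc n) f ≡ f 0 + ∑[ i < n ] f (suc i)
  ∑<-first zero    f = +-comm 0 (f 0)
  ∑<-first (suc n) f = trans (cong (_+ f (suc n)) (∑<-first n f)) (+-assoc (f 0) _ _)

  ∑<-ones : ∀ n → ∑[ i < n ] 1 ≡ n
  ∑<-ones zero    = refl
  ∑<-ones (suc n) = trans (cong (_+ 1) (∑<-ones n)) (+-comm n 1)

  ∑<-from : ∀ lo hi (f : ℕ → ℕ) → ∑[ i < hi ] (𝟙 (lo ≤ᵇ i) * f i) ≡ ∑[ k < hi ∸ lo ] f (lo + k)
  ∑<-from lo zero      f = cong (λ n → ∑[ k < n ] f (lo + k)) (sym (0∸n≡0 lo))
  ∑<-from lo (suc hi) f with lo ≤ᵇ hi | ≤ᵇ-reflects-≤ lo hi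
  ... | true  | ofʸ lo≤hi = begin
    ∑[ i < hi ] (𝟙 (lo ≤ᵇ i) * f i) + (f hi + 0)
      ≡⟨ cong₂ _+_ (∑<-from lo hi f) (+-identityʳ (f hi)) ⟩
    ∑[ k < hi ∸ lo ] f (lo + k) + f hi
      ≡⟨ cong (λ j → ∑[ k < hi ∸ lo ] f (lo + k) + f j) (sym (m+[n∸m]≡n lo≤hi)) ⟩
    ∑[ k < suc (hi ∸ lo) ] f (lo + k)
      ≡⟨ cong (λ n → ∑[ k < n ] f (lo + k)) (sym (+-∸-assoc 1 lo≤hi)) ⟩
    ∑[ k < suc hi ∸ lo ] f (lo + k) ∎
  ... | false | ofⁿ lo≰hi = begin
    ∑[ i < hi ] (𝟙 (lo ≤ᵇ i) * f i) + 0   ≡⟨ +-identityʳ _ ⟩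
    ∑[ i < hi ] (𝟙 (lo ≤ᵇ i) * f i)       ≡⟨ ∑<-from lo hi f ⟩
    ∑[ k < hi ∸ lo ] f (lo + k)           ≡⟨ cong (λ n → ∑[ k < n ] f (lo + k)) both-empty ⟩
    ∑[ k < suc hi ∸ lo ] f (lo + k)       ∎
    where
    hi<lo = ≰⇒> lo≰hi
    both-empty : hi ∸ lo ≡ suc hi ∸ lo
    both-empty = trans (m≤n⇒m∸n≡0 (<⇒≤ hi<lo)) (sym (m≤n⇒m∸n≡0 hi<lo))

  ∑<-below : ∀ hi r (f : ℕ → ℕ) → ∑[ i < hi + r ] (𝟙 (i <ᵇ hi) * f i) ≡ ∑< hi f
  ∑<-below hi zero    f = begin
    ∑[ i < hi + 0 ] (𝟙 (i <ᵇ hi) * f i)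
      ≡⟨ cong (λ n → ∑[ i < n ] (𝟙 (i <ᵇ hi) * f i)) (+-identityʳ hi) ⟩
    ∑[ i < hi ] (𝟙 (i <ᵇ hi) * f i)
      ≡⟨ ∑<-cong hi below ⟩
    ∑< hi f ∎
    where
    below : ∀ {i} → i < hi → 𝟙 (i <ᵇ hi) * f i ≡ f i
    below {i} i<hi = trans (cong (λ b → 𝟙 b * f i) (T⇒≡true (<⇒<ᵇ i<hi))) (*-identityˡ (f i))
  ∑<-below hi (suc r) f = begin
    ∑[ i < hi + suc r ] (𝟙 (i <ᵇ hi) * f i)
      ≡⟨ cong (λ n → ∑[ i < n ] (𝟙 (i <ᵇ hi) * f i)) (+-suc hi r) ⟩
    ∑[ i < hi + r ] (𝟙 (i <ᵇ hi) * f i) + 𝟙 (hi + r <ᵇ hi) * f (hi + r)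
      ≡⟨ cong (λ b → ∑[ i < hi + r ] (𝟙 (i <ᵇ hi) * f i) + 𝟙 b * f (hi + r)) (≥⇒<ᵇ≡false (m≤m+n hi r)) ⟩
    ∑[ i < hi + r ] (𝟙 (i <ᵇ hi) * f i) + 0
      ≡⟨ +-identityʳ _ ⟩
    ∑[ i < hi + r ] (𝟙 (i <ᵇ hi) * f i)
      ≡⟨ ∑<-below hi r f ⟩
    ∑< hi f ∎

  inRange : ℕ → ℕ → ℕ → Bool
  inRange lo hi i = (i <ᵇ hi) ∧ (lo ≤ᵇ i)

  ∑<-inRange : ∀ lo hi {M} (f : ℕ → ℕ) → hi ≤ M →
    ∑[ i < M ] (𝟙 (inRange lo hi i) * f i) ≡ ∑[ k < hi ∸ lo ] f (lo + k)
  ∑<-inRange lo hi {M} f hi≤M = begin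
    ∑[ i < M ] (𝟙 (inRange lo hi i) * f i)
      ≡⟨ ∑<-cong M (λ {i} _ → 𝟙-∧-* (i <ᵇ hi) (lo ≤ᵇ i) (f i)) ⟩
    ∑[ i < M ] (𝟙 (i <ᵇ hi) * (𝟙 (lo ≤ᵇ i) * f i))
      ≡⟨ cong (λ n → ∑[ i < n ] (𝟙 (i <ᵇ hi) * (𝟙 (lo ≤ᵇ i) * f i))) (sym (m+[n∸m]≡n hi≤M)) ⟩
    ∑[ i < hi + (M ∸ hi) ] (𝟙 (i <ᵇ hi) * (𝟙 (lo ≤ᵇ i) * f i))
      ≡⟨ ∑<-below hi (M ∸ hi) (λ i → 𝟙 (lo ≤ᵇ i) * f i) ⟩
    ∑[ i < hi ] (𝟙 (lo ≤ᵇ i) * f i)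
      ≡⟨ ∑<-from lo hi f ⟩
    ∑[ k < hi ∸ lo ] f (lo + k) ∎

  ∑<-count-inRange : ∀ lo hi {M} → hi ≤ M → ∑[ i < M ] 𝟙 (inRange lo hi i) ≡ hi ∸ lo
  ∑<-count-inRange lo hi {M} hi≤M = begin
    ∑[ i < M ] 𝟙 (inRange lo hi i)         ≡⟨ ∑<-cong M (λ {i} _ → sym (*-identityʳ (𝟙 (inRange lo hi i)))) ⟩
    ∑[ i < M ] (𝟙 (inRange lo hi i) * 1)   ≡⟨ ∑<-inRange lo hi (λ _ → 1) hi≤M ⟩
    ∑[ k < hi ∸ lo ] 1                       ≡⟨ ∑<-ones (hi ∸ lo) ⟩
    hi ∸ lo                                  ∎

  ∑ : {A : Set} → List A → (A → ℕ) → ℕ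
  ∑ xs f = sum (map f xs)

  syntax ∑ xs (λ x → e) = ∑[ x ∈ xs ] e

  module _ {A : Set} where

    ∑-cong : ∀ (xs : List A) {f g : A → ℕ} → (∀ x → f x ≡ g x) → ∑ xs f ≡ ∑ xs g
    ∑-cong []       f≡g = refl
    ∑-cong (x ∷ xs) f≡g = cong₂ _+_ (f≡g x) (∑-cong xs f≡g)

    ∑-zeros : ∀ (xs : List A) → ∑[ x ∈ xs ] 0 ≡ 0
    ∑-zeros []       = refl
    ∑-zeros (x ∷ xs) = ∑-zeros xs

    ∑-+ : ∀ (xs : List A) (f g : A → ℕ) → ∑[ x ∈ xs ] (f x + g x) ≡ ∑ xs f + ∑ xs g
    ∑-+ []       f g = refl
    ∑-+ (x ∷ xs) f g = trans (cong (f x + g x +_) (∑-+ xs f g)) (interchange (f x) (g x) (∑ xs f) (∑ xs g))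

    ∑-*ˡ : ∀ (xs : List A) c (f : A → ℕ) → ∑[ x ∈ xs ] (c * f x) ≡ c * ∑ xs f
    ∑-*ˡ []       c f = sym (*-zeroʳ c)
    ∑-*ˡ (x ∷ xs) c f = trans (cong (c * f x +_) (∑-*ˡ xs c f)) (sym (*-distribˡ-+ c (f x) (∑ xs f)))

    ∑-map : ∀ {B : Set} (g : A → B) (xs : List A) (f : B → ℕ) → ∑ (map g xs) f ≡ ∑[ x ∈ xs ] f (g x)
    ∑-map g xs f = cong sum (sym (map-∘ xs))

    ∑-concatMap : ∀ {B : Set} (g : A → List B) (xs : List A) (f : B → ℕ) →
      ∑ (concatMap g xs) f ≡ ∑[ x ∈ xs ] ∑ (g x) f
    ∑-concatMap g []       f = refl
    ∑-concatMap g (x ∷ xs) f = begin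
      sum (map f (g x ++ concatMap g xs))          ≡⟨ cong sum (map-++ f (g x) (concatMap g xs)) ⟩
      sum (map f (g x) ++ map f (concatMap g xs))  ≡⟨ sum-++ (map f (g x)) _ ⟩
      ∑ (g x) f + ∑ (concatMap g xs) f             ≡⟨ cong (∑ (g x) f +_) (∑-concatMap g xs f) ⟩
      ∑ (g x) f + ∑[ y ∈ xs ] ∑ (g y) f            ∎

    ∑<-∑-comm : ∀ n (xs : List A) (F : ℕ → A → ℕ) →
      ∑[ k < n ] ∑[ x ∈ xs ] F k x ≡ ∑[ x ∈ xs ] ∑[ k < n ] F k x
    ∑<-∑-comm zero    xs F = sym (∑-zeros xs)
    ∑<-∑-comm (suc n) xs F = trans (cong (_+ ∑[ x ∈ xs ] F n x) (∑<-∑-comm n xs F))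
                                    (sym (∑-+ xs (λ x → ∑[ k < n ] F k x) (F n)))

    length-filterᵇ : ∀ (P : A → Bool) xs → length (filterᵇ P xs) ≡ ∑[ x ∈ xs ] 𝟙 (P x)
    length-filterᵇ P []       = refl
    length-filterᵇ P (x ∷ xs) with P x
    ... | true  = cong suc (length-filterᵇ P xs)
    ... | false = length-filterᵇ P xs

  ∑-applyUpTo : ∀ (g : ℕ → ℕ) n (f : ℕ → ℕ) → ∑ (applyUpTo g n) f ≡ ∑[ i < n ] f (g i)
  ∑-applyUpTo g zero    f = refl
  ∑-applyUpTo g (suc n) f = trans (cong (f (g 0) +_) (∑-applyUpTo (g ∘ suc) n f)) (sym (∑<-first n (f ∘ g)))

  ∑-upTo : ∀ n (f : ℕ → ℕ) → ∑ (upTo n) f ≡ ∑< n f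
  ∑-upTo = ∑-applyUpTo id

  countListsUpTo : List Column → ℕ → (List Column → Bool) → ℕ
  countListsUpTo L K P = ∑[ k < suc K ] ∑[ cs ∈ listsOfLength L k ] 𝟙 (P cs)

  restrictedOfArea : ℕ → ℕ → List Column → Bool
  restrictedOfArea d n cs = isDCCP cs ∧ isRestricted d cs ∧ (area cs ≡ᵇ n)

  v≡countListsUpTo : ∀ d n → v d n ≡ countListsUpTo (entries n) n (restrictedOfArea d n)
  v≡countListsUpTo d n = begin
    length (filterᵇ P (candidates n))
      ≡⟨ length-filterᵇ P (candidates n) ⟩
    ∑[ cs ∈ candidates n ] 𝟙 (P cs)
      ≡⟨ ∑-concatMap (listsOfLength (entries n)) (upTo (suc n)) (𝟙 ∘ P) ⟩
    ∑[ k ∈ upTo (suc n) ] ∑[ cs ∈ listsOfLength (entries n) k ] 𝟙 (P cs)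
      ≡⟨ ∑-upTo (suc n) (λ k → ∑[ cs ∈ listsOfLength (entries n) k ] 𝟙 (P cs)) ⟩
    countListsUpTo (entries n) n P ∎
    where P = restrictedOfArea d n

  module _ (L : List Column) where

    countListsUpTo-zero : ∀ P → countListsUpTo L 0 P ≡ 𝟙 (P [])
    countListsUpTo-zero P = +-identityʳ (𝟙 (P []))

    countListsUpTo-suc : ∀ K P →
      countListsUpTo L (suc K) P ≡ 𝟙 (P []) + ∑[ x ∈ L ] countListsUpTo L K (λ cs → P (x ∷ cs))
    countListsUpTo-suc K P = begin
      countListsUpTo L (suc K) P
        ≡⟨ ∑<-first (suc K) (λ k → ∑[ cs ∈ listsOfLength L k ] 𝟙 (P cs)) ⟩
      (𝟙 (P []) + 0) + ∑[ k < suc K ] ∑[ cs ∈ listsOfLength L (suc k) ] 𝟙 (P cs)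
        ≡⟨ cong₂ _+_ (+-identityʳ (𝟙 (P []))) (∑<-cong (suc K) (λ {k} _ → peel k)) ⟩
      𝟙 (P []) + ∑[ k < suc K ] ∑[ x ∈ L ] ∑[ cs ∈ listsOfLength L k ] 𝟙 (P (x ∷ cs))
        ≡⟨ cong (𝟙 (P []) +_) (∑<-∑-comm (suc K) L (λ k x → ∑[ cs ∈ listsOfLength L k ] 𝟙 (P (x ∷ cs)))) ⟩
      𝟙 (P []) + ∑[ x ∈ L ] countListsUpTo L K (λ cs → P (x ∷ cs)) ∎
      where
      peel : ∀ k → ∑[ cs ∈ listsOfLength L (suc k) ] 𝟙 (P cs)
                 ≡ ∑[ x ∈ L ] ∑[ cs ∈ listsOfLength L k ] 𝟙 (P (x ∷ cs))
      peel k = trans (∑-concatMap (λ x → map (x ∷_) (listsOfLength L k)) L (𝟙 ∘ P))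
                     (∑-cong L (λ x → ∑-map (x ∷_) (listsOfLength L k) (𝟙 ∘ P)))

    countListsUpTo-cong : ∀ K {P Q : List Column → Bool} → (∀ cs → P cs ≡ Q cs) →
      countListsUpTo L K P ≡ countListsUpTo L K Q
    countListsUpTo-cong K P≡Q =
      ∑<-cong (suc K) (λ {k} _ → ∑-cong (listsOfLength L k) (cong 𝟙 ∘ P≡Q))

    countListsUpTo-∧ : ∀ K b P → countListsUpTo L K (λ cs → b ∧ P cs) ≡ 𝟙 b * countListsUpTo L K P
    countListsUpTo-∧ K b P = begin
      countListsUpTo L K (λ cs → b ∧ P cs)
        ≡⟨ ∑<-cong (suc K) (λ {k} _ → trans (∑-cong (listsOfLength L k) (λ cs → 𝟙-∧ b (P cs)))
                                             (∑-*ˡ (listsOfLength L k) (𝟙 b) (𝟙 ∘ P))) ⟩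
      ∑[ k < suc K ] (𝟙 b * ∑[ cs ∈ listsOfLength L k ] 𝟙 (P cs))
        ≡⟨ ∑<-*ˡ (suc K) (𝟙 b) (λ k → ∑[ cs ∈ listsOfLength L k ] 𝟙 (P cs)) ⟩
      𝟙 b * countListsUpTo L K P ∎

  ∑-entries : ∀ N (F : Column → ℕ) → ∑[ x ∈ entries N ] F x ≡ ∑[ a < suc N ] ∑[ h < suc N ] F (a , h)
  ∑-entries N F = begin
    ∑[ x ∈ entries N ] F x
      ≡⟨ ∑-concatMap (λ a → map (a ,_) (upTo (suc N))) (upTo (suc N)) F ⟩
    ∑[ a ∈ upTo (suc N) ] ∑[ x ∈ map (a ,_) (upTo (suc N)) ] F x
      ≡⟨ ∑-cong (upTo (suc N)) (λ a → trans (∑-map (a ,_) (upTo (suc N)) F) (∑-upTo (suc N) (λ h → F (a , h)))) ⟩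
    ∑[ a ∈ upTo (suc N) ] ∑[ h < suc N ] F (a , h)
      ≡⟨ ∑-upTo (suc N) (λ a → ∑[ h < suc N ] F (a , h)) ⟩
    ∑[ a < suc N ] ∑[ h < suc N ] F (a , h) ∎

  -- `continues d lo c m cs`: the columns cs may follow the column c in a dccp, the first of them
  -- at altitude at least lo, each later one at least d higher than its predecessor, with total area m.
  continues : ℕ → ℕ → Column → ℕ → List Column → Bool
  continues d lo (a , h) m []                = 0 ≡ᵇ m
  continues d lo (a , h) m ((a′ , h′) ∷ cs) =
    inRange lo (a + h) a′ ∧ inRange 1 (suc m) h′ ∧ continues d (a′ + d) (a′ , h′) (m ∸ h′) cs

  +-≡ᵇ : ∀ h x m → (h + x ≡ᵇ m) ≡ (h <ᵇ suc m) ∧ (x ≡ᵇ m ∸ h)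
  +-≡ᵇ zero    x m       = refl
  +-≡ᵇ (suc h) x zero    = refl
  +-≡ᵇ (suc h) x (suc m) = +-≡ᵇ h x m

  ≤ᵇ-absorb : ∀ a d a′ → (a ≤ᵇ a′) ∧ (a + d ≤ᵇ a′) ≡ (a + d ≤ᵇ a′)
  ≤ᵇ-absorb a d a′ with a + d ≤ᵇ a′ | ≤ᵇ-reflects-≤ (a + d) a′
  ... | true  | ofʸ a+d≤a′ = trans (∧-identityʳ (a ≤ᵇ a′)) (T⇒≡true (≤⇒≤ᵇ (≤-trans (m≤m+n a d) a+d≤a′)))
  ... | false | _          = ∧-zeroʳ (a ≤ᵇ a′)

  continues-gapped : ∀ d a h m cs →
    continues d (a + d) (a , h) m cs ≡ stepOK (a , h) cs ∧ gapsAtLeast d ((a , h) ∷ cs) ∧ (area cs ≡ᵇ m)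
  continues-gapped d a h m []                = refl
  continues-gapped d a h m ((a′ , h′) ∷ cs) = begin
    (B ∧ D) ∧ (E ∧ C) ∧ continues d (a′ + d) (a′ , h′) (m ∸ h′) cs
      ≡⟨ cong (λ z → (B ∧ D) ∧ (E ∧ C) ∧ z) (continues-gapped d a′ h′ (m ∸ h′) cs) ⟩
    (B ∧ D) ∧ (E ∧ C) ∧ (X ∧ Y ∧ Z)
      ≡⟨ cong (λ z → (B ∧ z) ∧ (E ∧ C) ∧ (X ∧ Y ∧ Z)) (sym (≤ᵇ-absorb a d a′)) ⟩
    (B ∧ A ∧ D) ∧ (E ∧ C) ∧ (X ∧ Y ∧ Z)
      ≡⟨ solve 8 (λ a b c d e x y z → (b ∧′ a ∧′ d) ∧′ (e ∧′ c) ∧′ (x ∧′ y ∧′ z)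
                                     ⊜ (a ∧′ b ∧′ c ∧′ x) ∧′ (d ∧′ y) ∧′ (e ∧′ z)) refl A B C D E X Y Z ⟩
    (A ∧ B ∧ C ∧ X) ∧ (D ∧ Y) ∧ (E ∧ Z)
      ≡⟨ cong (λ z → (A ∧ B ∧ C ∧ X) ∧ (D ∧ Y) ∧ z) (sym (+-≡ᵇ h′ (area cs) m)) ⟩
    (A ∧ B ∧ C ∧ X) ∧ (D ∧ Y) ∧ (h′ + area cs ≡ᵇ m) ∎
    where
    A = a ≤ᵇ a′
    B = a′ <ᵇ a + h
    C = 1 ≤ᵇ h′
    D = a + d ≤ᵇ a′
    E = h′ <ᵇ suc m
    X = stepOK (a′ , h′) cs
    Y = gapsAtLeast d ((a′ , h′) ∷ cs)
    Z = area cs ≡ᵇ m ∸ h′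

  continues-ungapped : ∀ d a h m cs →
    continues d a (a , h) m cs ≡ stepOK (a , h) cs ∧ gapsAtLeast d cs ∧ (area cs ≡ᵇ m)
  continues-ungapped d a h m []                = refl
  continues-ungapped d a h m ((a′ , h′) ∷ cs) = begin
    (B ∧ A) ∧ (E ∧ C) ∧ continues d (a′ + d) (a′ , h′) (m ∸ h′) cs
      ≡⟨ cong (λ z → (B ∧ A) ∧ (E ∧ C) ∧ z) (continues-gapped d a′ h′ (m ∸ h′) cs) ⟩
    (B ∧ A) ∧ (E ∧ C) ∧ (X ∧ Y ∧ Z)
      ≡⟨ solve 7 (λ a b c e x y z → (b ∧′ a) ∧′ (e ∧′ c) ∧′ (x ∧′ y ∧′ z)
                                   ⊜ (a ∧′ b ∧′ c ∧′ x) ∧′ y ∧′ (e ∧′ z)) refl A B C E X Y Z ⟩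
    (A ∧ B ∧ C ∧ X) ∧ Y ∧ (E ∧ Z)
      ≡⟨ cong (λ z → (A ∧ B ∧ C ∧ X) ∧ Y ∧ z) (sym (+-≡ᵇ h′ (area cs) m)) ⟩
    (A ∧ B ∧ C ∧ X) ∧ Y ∧ (h′ + area cs ≡ᵇ m) ∎
    where
    A = a ≤ᵇ a′
    B = a′ <ᵇ a + h
    C = 1 ≤ᵇ h′
    E = h′ <ᵇ suc m
    X = stepOK (a′ , h′) cs
    Y = gapsAtLeast d ((a′ , h′) ∷ cs)
    Z = area cs ≡ᵇ m ∸ h′

  restrictedOfArea-cons : ∀ d n a h cs →
    restrictedOfArea d n ((a , h) ∷ cs) ≡ ((a ≡ᵇ 0) ∧ inRange 1 (suc n) h) ∧ continues d a (a , h) (n ∸ h) cs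
  restrictedOfArea-cons d n a h cs = begin
    (F ∧ C ∧ X) ∧ Y ∧ (h + area cs ≡ᵇ n)
      ≡⟨ cong (λ z → (F ∧ C ∧ X) ∧ Y ∧ z) (+-≡ᵇ h (area cs) n) ⟩
    (F ∧ C ∧ X) ∧ Y ∧ (E ∧ Z)
      ≡⟨ solve 6 (λ f c x y e z → (f ∧′ c ∧′ x) ∧′ y ∧′ (e ∧′ z)
                                 ⊜ (f ∧′ e ∧′ c) ∧′ (x ∧′ y ∧′ z)) refl F C X Y E Z ⟩
    (F ∧ E ∧ C) ∧ (X ∧ Y ∧ Z)
      ≡⟨ cong ((F ∧ E ∧ C) ∧_) (sym (continues-ungapped d a h (n ∸ h) cs)) ⟩
    (F ∧ E ∧ C) ∧ continues d a (a , h) (n ∸ h) cs ∎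
    where
    F = a ≡ᵇ 0
    C = 1 ≤ᵇ h
    E = h <ᵇ suc n
    X = stepOK (a , h) cs
    Y = gapsAtLeast d cs
    Z = area cs ≡ᵇ n ∸ h

  inRange⇒< : ∀ lo {hi} i → T (inRange lo hi i) → i < hi
  inRange⇒< lo {hi} i t = <ᵇ⇒< i hi (proj₁ (Equivalence.to T-∧ t))

  completions : (ℕ → ℕ) → ℕ → ℕ → ℕ
  completions s w m = 𝟙 (0 ≡ᵇ m) + w * s m

  -- strictUpTo d K m counts the nonempty dccps of area m with at most K columns in which every
  -- difference a_{i+1} - a_i, including a₂ - a₁, is at least d.
  strictUpTo : ℕ → ℕ → ℕ → ℕ
  strictUpTo d zero    m = 0
  strictUpTo d (suc K) m = ∑[ k < m ] completions (strictUpTo d K) (suc k ∸ d) (m ∸ suc k)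

  -- The bound guarantees that entries N contains every column that can come next.
  count-continuations : ∀ d {N} K lo a h m → a + h + m ≤ N →
    countListsUpTo (entries N) K (continues d lo (a , h) m) ≡ completions (strictUpTo d K) (a + h ∸ lo) m
  count-continuations d {N} zero lo a h m _ =
    trans (countListsUpTo-zero (entries N) (continues d lo (a , h) m))
          (trans (sym (+-identityʳ (𝟙 (0 ≡ᵇ m)))) (cong (𝟙 (0 ≡ᵇ m) +_) (sym (*-zeroʳ (a + h ∸ lo)))))
  count-continuations d {N} (suc K) lo a h m a+h+m≤N =
    trans (countListsUpTo-suc E K (continues d lo (a , h) m)) (cong (𝟙 (0 ≡ᵇ m) +_) next-columns)
    where
    E = entries N
    G : ℕ → ℕ
    G h′ = completions (strictUpTo d K) (h′ ∸ d) (m ∸ h′)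

    one-column : ∀ a′ h′ → countListsUpTo E K (λ cs → continues d lo (a , h) m ((a′ , h′) ∷ cs))
                         ≡ 𝟙 (inRange lo (a + h) a′) * (𝟙 (inRange 1 (suc m) h′) * G h′)
    one-column a′ h′ = begin
      countListsUpTo E K (λ cs → I₁ ∧ I₂ ∧ P cs)     ≡⟨ countListsUpTo-∧ E K I₁ (λ cs → I₂ ∧ P cs) ⟩
      𝟙 I₁ * countListsUpTo E K (λ cs → I₂ ∧ P cs)   ≡⟨ cong (𝟙 I₁ *_) (countListsUpTo-∧ E K I₂ P) ⟩
      𝟙 I₁ * (𝟙 I₂ * countListsUpTo E K P)          ≡⟨ 𝟙-*-cong I₁ (𝟙-*-cong I₂ ∘ tail-count) ⟩
      𝟙 I₁ * (𝟙 I₂ * G h′)                           ∎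
      where
      I₁ = inRange lo (a + h) a′
      I₂ = inRange 1 (suc m) h′
      P = continues d (a′ + d) (a′ , h′) (m ∸ h′)
      tail-count : T I₁ → T I₂ → countListsUpTo E K P ≡ G h′
      tail-count t₁ t₂ = begin
        countListsUpTo E K P
          ≡⟨ count-continuations d K (a′ + d) a′ h′ (m ∸ h′) bound ⟩
        completions (strictUpTo d K) (a′ + h′ ∸ (a′ + d)) (m ∸ h′)
          ≡⟨ cong (λ w → completions (strictUpTo d K) w (m ∸ h′)) ([m+n]∸[m+o]≡n∸o a′ h′ d) ⟩
        G h′ ∎
        where
        bound : a′ + h′ + (m ∸ h′) ≤ N
        bound = ≤-trans (≤-reflexive (trans (+-assoc a′ h′ (m ∸ h′)) (cong (a′ +_) (m+[n∸m]≡n h′≤m))))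
                        (≤-trans (+-monoˡ-≤ m (<⇒≤ (inRange⇒< lo a′ t₁))) a+h+m≤N)
          where h′≤m = s≤s⁻¹ (inRange⇒< 1 h′ t₂)

    next-columns : ∑[ x ∈ E ] countListsUpTo E K (λ cs → continues d lo (a , h) m (x ∷ cs))
                 ≡ (a + h ∸ lo) * strictUpTo d (suc K) m
    next-columns = begin
      ∑[ x ∈ E ] countListsUpTo E K (λ cs → continues d lo (a , h) m (x ∷ cs))
        ≡⟨ ∑-entries N (λ x → countListsUpTo E K (λ cs → continues d lo (a , h) m (x ∷ cs))) ⟩
      ∑[ a′ < suc N ] ∑[ h′ < suc N ] countListsUpTo E K (λ cs → continues d lo (a , h) m ((a′ , h′) ∷ cs))
        ≡⟨ ∑<-cong (suc N) (λ {a′} _ → trans (∑<-cong (suc N) (λ {h′} _ → one-column a′ h′))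
                                              (∑<-*ˡ (suc N) (𝟙 (inRange lo (a + h) a′)) heights)) ⟩
      ∑[ a′ < suc N ] (𝟙 (inRange lo (a + h) a′) * ∑< (suc N) heights)
        ≡⟨ ∑<-*ʳ (suc N) (∑< (suc N) heights) (λ a′ → 𝟙 (inRange lo (a + h) a′)) ⟩
      ∑[ a′ < suc N ] 𝟙 (inRange lo (a + h) a′) * ∑< (suc N) heights
        ≡⟨ cong₂ _*_ (∑<-count-inRange lo (a + h) (m≤n⇒m≤1+n (≤-trans (m≤m+n (a + h) m) a+h+m≤N)))
                     (∑<-inRange 1 (suc m) G (s≤s (≤-trans (m≤n+m m (a + h)) a+h+m≤N))) ⟩
      (a + h ∸ lo) * strictUpTo d (suc K) m ∎
      where
      heights : ℕ → ℕ
      heights h′ = 𝟙 (inRange 1 (suc m) h′) * G h′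

  strictUpTo-zero : ∀ d K → strictUpTo d K 0 ≡ 0
  strictUpTo-zero d zero    = refl
  strictUpTo-zero d (suc K) = refl

  -- A dccp of area m has at most m columns.
  strictUpTo-stable : ∀ d {K K′ m} → m ≤ K → m ≤ K′ → strictUpTo d K m ≡ strictUpTo d K′ m
  strictUpTo-stable d {K} {K′} {zero} _ _ = trans (strictUpTo-zero d K) (sym (strictUpTo-zero d K′))
  strictUpTo-stable d {suc K} {suc K′} {suc m} (s≤s m≤K) (s≤s m≤K′) =
    ∑<-cong (suc m) (λ {k} _ → cong (λ x → 𝟙 (0 ≡ᵇ m ∸ k) + (suc k ∸ d) * x)
      (strictUpTo-stable d (≤-trans (m∸n≤m m k) m≤K) (≤-trans (m∸n≤m m k) m≤K′)))

  strict : ℕ → ℕ → ℕ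
  strict d m = strictUpTo d m m

  strictUpTo≡strict : ∀ d {K m} → m ≤ K → strictUpTo d K m ≡ strict d m
  strictUpTo≡strict d m≤K = strictUpTo-stable d m≤K ≤-refl

  _⋆_ : (ℕ → ℕ) → (ℕ → ℕ) → ℕ → ℕ
  (w ⋆ s) m = ∑[ k < m ] (w (suc k) * s (m ∸ suc k))

  ⋆-congʳ : ∀ w m {s t : ℕ → ℕ} → (∀ {j} → j < m → s j ≡ t j) → (w ⋆ s) m ≡ (w ⋆ t) m
  ⋆-congʳ w zero    s≡t = refl
  ⋆-congʳ w (suc m) s≡t = ∑<-cong (suc m) (λ {k} _ → cong (w (suc k) *_) (s≡t (s≤s (m∸n≤m m k))))

  ∑<-completions : ∀ (w s : ℕ → ℕ) m →
    ∑[ k < suc m ] completions s (w (suc k)) (suc m ∸ suc k) ≡ 1 + (w ⋆ s) (suc m)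
  ∑<-completions w s m = trans (∑<-+ (suc m) (λ k → 𝟙 (0 ≡ᵇ m ∸ k)) _) (cong (_+ (w ⋆ s) (suc m)) only-last)
    where
    only-last : ∑[ k < suc m ] 𝟙 (0 ≡ᵇ m ∸ k) ≡ 1
    only-last = cong₂ _+_ (∑<-zero m (λ {k} k<m → 𝟙-≢0 (m>n⇒m∸n≢0 k<m)))
                          (cong (λ x → 𝟙 (0 ≡ᵇ x)) (n∸n≡0 m))
      where
      𝟙-≢0 : ∀ {x} → x ≢ 0 → 𝟙 (0 ≡ᵇ x) ≡ 0
      𝟙-≢0 {zero}  x≢0 = contradiction refl x≢0
      𝟙-≢0 {suc x} _   = refl

  strict-suc : ∀ d m → strict d (suc m) ≡ 1 + ((λ h → h ∸ d) ⋆ strict d) (suc m)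
  strict-suc d m = begin
    strictUpTo d (suc m) (suc m)
      ≡⟨ ∑<-completions (λ h → h ∸ d) (strictUpTo d m) m ⟩
    1 + ((λ h → h ∸ d) ⋆ strictUpTo d m) (suc m)
      ≡⟨ cong (1 +_) (⋆-congʳ (λ h → h ∸ d) (suc m) (strictUpTo≡strict d ∘ s≤s⁻¹)) ⟩
    1 + ((λ h → h ∸ d) ⋆ strict d) (suc m) ∎

  ∑<-𝟙-≡ᵇ0 : ∀ n → ∑[ a < suc n ] 𝟙 (a ≡ᵇ 0) ≡ 1
  ∑<-𝟙-≡ᵇ0 n = trans (∑<-first n (λ a → 𝟙 (a ≡ᵇ 0))) (cong suc (∑<-zero n (λ _ → refl)))

  v≡1+id⋆strict : ∀ d n → v d n ≡ 1 + (id ⋆ strict d) n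
  v≡1+id⋆strict d zero    = refl
  v≡1+id⋆strict d (suc n) = begin
    v d N
      ≡⟨ v≡countListsUpTo d N ⟩
    countListsUpTo E N P
      ≡⟨ countListsUpTo-suc E n P ⟩
    ∑[ x ∈ E ] countListsUpTo E n (λ cs → P (x ∷ cs))
      ≡⟨ ∑-entries N (λ x → countListsUpTo E n (λ cs → P (x ∷ cs))) ⟩
    ∑[ a < suc N ] ∑[ h < suc N ] countListsUpTo E n (λ cs → P ((a , h) ∷ cs))
      ≡⟨ ∑<-cong (suc N) (λ {a} _ → trans (∑<-cong (suc N) (λ {h} _ → first-column a h))
                                           (∑<-*ˡ (suc N) (𝟙 (a ≡ᵇ 0)) heights)) ⟩
    ∑[ a < suc N ] (𝟙 (a ≡ᵇ 0) * ∑< (suc N) heights)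
      ≡⟨ ∑<-*ʳ (suc N) (∑< (suc N) heights) (λ a → 𝟙 (a ≡ᵇ 0)) ⟩
    ∑[ a < suc N ] 𝟙 (a ≡ᵇ 0) * ∑< (suc N) heights
      ≡⟨ trans (cong (_* ∑< (suc N) heights) (∑<-𝟙-≡ᵇ0 N)) (*-identityˡ _) ⟩
    ∑< (suc N) heights
      ≡⟨ ∑<-inRange 1 (suc N) G ≤-refl ⟩
    ∑[ k < N ] completions (strictUpTo d n) (suc k) (N ∸ suc k)
      ≡⟨ ∑<-completions id (strictUpTo d n) n ⟩
    1 + (id ⋆ strictUpTo d n) N
      ≡⟨ cong (1 +_) (⋆-congʳ id N (strictUpTo≡strict d ∘ s≤s⁻¹)) ⟩
    1 + (id ⋆ strict d) N ∎
    where
    N = suc n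
    E = entries N
    P = restrictedOfArea d N
    G : ℕ → ℕ
    G h = completions (strictUpTo d n) h (N ∸ h)
    heights : ℕ → ℕ
    heights h = 𝟙 (inRange 1 (suc N) h) * G h

    first-column : ∀ a h → countListsUpTo E n (λ cs → P ((a , h) ∷ cs)) ≡ 𝟙 (a ≡ᵇ 0) * heights h
    first-column a h = begin
      countListsUpTo E n (λ cs → P ((a , h) ∷ cs))
        ≡⟨ countListsUpTo-cong E n (restrictedOfArea-cons d N a h) ⟩
      countListsUpTo E n (λ cs → ((a ≡ᵇ 0) ∧ I) ∧ Q cs)
        ≡⟨ countListsUpTo-∧ E n ((a ≡ᵇ 0) ∧ I) Q ⟩
      𝟙 ((a ≡ᵇ 0) ∧ I) * countListsUpTo E n Q
        ≡⟨ 𝟙-*-cong ((a ≡ᵇ 0) ∧ I) tail-count ⟩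
      𝟙 ((a ≡ᵇ 0) ∧ I) * G h
        ≡⟨ 𝟙-∧-* (a ≡ᵇ 0) I (G h) ⟩
      𝟙 (a ≡ᵇ 0) * heights h ∎
      where
      I = inRange 1 (suc N) h
      Q = continues d a (a , h) (N ∸ h)
      tail-count : T ((a ≡ᵇ 0) ∧ I) → countListsUpTo E n Q ≡ G h
      tail-count t = trans (count-continuations d n a a h (N ∸ h) (≤-reflexive bound))
                           (cong (λ w → completions (strictUpTo d n) w (N ∸ h)) (m+n∸m≡n a h))
        where
        a≡0 : a ≡ 0
        a≡0 = ≡ᵇ⇒≡ a 0 (proj₁ (Equivalence.to (T-∧ {a ≡ᵇ 0}) t))
        bound : a + h + (N ∸ h) ≡ N
        bound = trans (cong (λ x → x + h + (N ∸ h)) a≡0)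
                      (m+[n∸m]≡n (s≤s⁻¹ (inRange⇒< 1 h (proj₂ (Equivalence.to (T-∧ {a ≡ᵇ 0}) t)))))

  ⋆-∸ : ∀ d (s : ℕ → ℕ) m → ((λ h → h ∸ d) ⋆ s) m ≡ (id ⋆ s) (m ∸ d)
  ⋆-∸ zero    s m       = refl
  ⋆-∸ (suc d) s zero    = refl
  ⋆-∸ (suc d) s (suc m) = begin
    ((λ h → h ∸ suc d) ⋆ s) (suc m)      ≡⟨ ∑<-first m (λ k → (suc k ∸ suc d) * s (m ∸ k)) ⟩
    (0 ∸ d) * s m + ((λ h → h ∸ d) ⋆ s) m ≡⟨ cong (λ x → x * s m + ((λ h → h ∸ d) ⋆ s) m) (0∸n≡0 d) ⟩
    ((λ h → h ∸ d) ⋆ s) m                 ≡⟨ ⋆-∸ d s m ⟩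
    (id ⋆ s) (m ∸ d)                      ∎

  ⋆-const-suc : ∀ (s : ℕ → ℕ) m → (const 1 ⋆ s) (suc m) ≡ s m + (const 1 ⋆ s) m
  ⋆-const-suc s m = trans (∑<-first m (λ k → 1 * s (m ∸ k))) (cong (_+ (const 1 ⋆ s) m) (*-identityˡ (s m)))

  ⋆-id-suc : ∀ (s : ℕ → ℕ) m → (id ⋆ s) (suc m) ≡ (const 1 ⋆ s) (suc m) + (id ⋆ s) m
  ⋆-id-suc s m = begin
    (id ⋆ s) (suc m)
      ≡⟨ ∑<-first m (λ k → suc k * s (m ∸ k)) ⟩
    1 * s m + ∑[ k < m ] (s (m ∸ suc k) + suc k * s (m ∸ suc k))
      ≡⟨ cong (1 * s m +_) (∑<-+ m (λ k → s (m ∸ suc k)) (λ k → suc k * s (m ∸ suc k))) ⟩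
    1 * s m + (∑[ k < m ] s (m ∸ suc k) + (id ⋆ s) m)
      ≡⟨ cong (λ x → 1 * s m + (x + (id ⋆ s) m)) (∑<-cong m (λ {k} _ → sym (*-identityˡ (s (m ∸ suc k))))) ⟩
    1 * s m + ((const 1 ⋆ s) m + (id ⋆ s) m)
      ≡⟨ sym (+-assoc (1 * s m) _ _) ⟩
    1 * s m + (const 1 ⋆ s) m + (id ⋆ s) m
      ≡⟨ cong (_+ (id ⋆ s) m) (sym (∑<-first m (λ k → 1 * s (m ∸ k)))) ⟩
    (const 1 ⋆ s) (suc m) + (id ⋆ s) m ∎

  ⋆-id-second-difference : ∀ (s : ℕ → ℕ) m →
    (id ⋆ s) (2 + m) + (id ⋆ s) m ≡ (id ⋆ s) (1 + m) + (id ⋆ s) (1 + m) + s (1 + m)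
  ⋆-id-second-difference s m = begin
    W (2 + m) + W m
      ≡⟨ cong (_+ W m) (⋆-id-suc s (1 + m)) ⟩
    Z (2 + m) + W (1 + m) + W m
      ≡⟨ cong (λ x → x + W (1 + m) + W m) (⋆-const-suc s (1 + m)) ⟩
    s (1 + m) + Z (1 + m) + W (1 + m) + W m
      ≡⟨ rearrange (s (1 + m)) (Z (1 + m)) (W (1 + m)) (W m) ⟩
    W (1 + m) + (Z (1 + m) + W m) + s (1 + m)
      ≡⟨ cong (λ x → W (1 + m) + x + s (1 + m)) (sym (⋆-id-suc s m)) ⟩
    W (1 + m) + W (1 + m) + s (1 + m) ∎
    where
    W = id ⋆ s
    Z = const 1 ⋆ s
    rearrange : ∀ a b c e → a + b + c + e ≡ c + (b + e) + a
    rearrange = solve-∀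

  v-recurrence : ∀ d m → v d (2 + m) + v d m ≡ v d (1 + m) + v d (1 + m) + v d (1 + m ∸ d)
  v-recurrence d m = begin
    v d (2 + m) + v d m
      ≡⟨ cong₂ _+_ (v′ (2 + m)) (v′ m) ⟩
    (1 + W (2 + m)) + (1 + W m)
      ≡⟨ rearrange₁ (W (2 + m)) (W m) ⟩
    2 + (W (2 + m) + W m)
      ≡⟨ cong (2 +_) (⋆-id-second-difference (strict d) m) ⟩
    2 + (W (1 + m) + W (1 + m) + strict d (1 + m))
      ≡⟨ cong (λ x → 2 + (W (1 + m) + W (1 + m) + x)) (strict-suc d m) ⟩
    2 + (W (1 + m) + W (1 + m) + (1 + ((λ h → h ∸ d) ⋆ strict d) (1 + m)))
      ≡⟨ cong (λ x → 2 + (W (1 + m) + W (1 + m) + (1 + x))) (⋆-∸ d (strict d) (1 + m)) ⟩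
    2 + (W (1 + m) + W (1 + m) + (1 + W (1 + m ∸ d)))
      ≡⟨ rearrange₂ (W (1 + m)) (W (1 + m ∸ d)) ⟩
    (1 + W (1 + m)) + (1 + W (1 + m)) + (1 + W (1 + m ∸ d))
      ≡⟨ sym (cong₂ _+_ (cong₂ _+_ (v′ (1 + m)) (v′ (1 + m))) (v′ (1 + m ∸ d))) ⟩
    v d (1 + m) + v d (1 + m) + v d (1 + m ∸ d) ∎
    where
    W = id ⋆ strict d
    v′ = v≡1+id⋆strict d
    rearrange₁ : ∀ a b → (1 + a) + (1 + b) ≡ 2 + (a + b)
    rearrange₁ = solve-∀
    rearrange₂ : ∀ a b → 2 + (a + a + (1 + b)) ≡ (1 + a) + (1 + a) + (1 + b)
    rearrange₂ = solve-∀

module PowerSeries where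

  open import Data.Bool using (true; false)
  open import Data.Nat using (ℕ; zero; suc; _∸_; _≡ᵇ_)
  import Data.Nat as ℕ
  open import Data.Integer using (ℤ; +_; -_; _+_; _-_; _*_)
  open import Data.Integer.Properties
  open import Data.Integer.Tactic.RingSolver using (solve-∀)
  open import Algebra.Properties.CommutativeSemigroup +-commutativeSemigroup using (interchange)
  open import Function using (const)
  open import Relation.Binary.PropositionalEquality
  open ≡-Reasoning
  open Enumeration using (v-recurrence)

  shift : ℕ → Series → Series
  shift zero    f n       = f n
  shift (suc k) f zero    = + 0
  shift (suc k) f (suc n) = shift k f n

  ∇ : Series → Series
  ∇ f n = f n - shift 1 f n

  𝟙 : Series
  𝟙 _ = + 1

  sumTo-cong : ∀ n {f g : ℕ → ℤ} → (∀ i → f i ≡ g i) → sumTo n f ≡ sumTo n g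
  sumTo-cong zero    f≡g = f≡g 0
  sumTo-cong (suc n) f≡g = cong₂ _+_ (sumTo-cong n f≡g) (f≡g (suc n))

  sumTo-zeros : ∀ n → sumTo n (const (+ 0)) ≡ + 0
  sumTo-zeros zero    = refl
  sumTo-zeros (suc n) = cong (_+ + 0) (sumTo-zeros n)

  sumTo-+ : ∀ n (f g : ℕ → ℤ) → sumTo n (λ i → f i + g i) ≡ sumTo n f + sumTo n g
  sumTo-+ zero    f g = refl
  sumTo-+ (suc n) f g = trans (cong (_+ (f (suc n) + g (suc n))) (sumTo-+ n f g))
                              (interchange (sumTo n f) (sumTo n g) (f (suc n)) (g (suc n)))

  sumTo-*ˡ : ∀ n c (f : ℕ → ℤ) → sumTo n (λ i → c * f i) ≡ c * sumTo n f
  sumTo-*ˡ zero    c f = refl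
  sumTo-*ˡ (suc n) c f = trans (cong (_+ c * f (suc n)) (sumTo-*ˡ n c f)) (sym (*-distribˡ-+ c (sumTo n f) (f (suc n))))

  sumTo-suc : ∀ n (f : ℕ → ℤ) → sumTo (suc n) f ≡ f 0 + sumTo n (λ i → f (suc i))
  sumTo-suc zero    f = refl
  sumTo-suc (suc n) f = trans (cong (_+ f (suc (suc n))) (sumTo-suc n f)) (+-assoc (f 0) _ _)

  ⊛-congˡ : ∀ {f f′} g n → (∀ i → f i ≡ f′ i) → (f ⊛ g) n ≡ (f′ ⊛ g) n
  ⊛-congˡ g n f≡f′ = sumTo-cong n (λ i → cong (_* g (n ∸ i)) (f≡f′ i))

  ⊛-distribʳ-⊕ : ∀ f g h n → ((f ⊕ g) ⊛ h) n ≡ (f ⊛ h) n + (g ⊛ h) n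
  ⊛-distribʳ-⊕ f g h n = trans (sumTo-cong n (λ i → *-distribʳ-+ (h (n ∸ i)) (f i) (g i))) (sumTo-+ n _ _)

  ⊛-scaleˡ : ∀ c f g n → ((λ i → c * f i) ⊛ g) n ≡ c * (f ⊛ g) n
  ⊛-scaleˡ c f g n = trans (sumTo-cong n (λ i → *-assoc c (f i) (g (n ∸ i)))) (sumTo-*ˡ n c _)

  mono-suc : ∀ c k j → mono c (suc k) (suc j) ≡ mono c k j
  mono-suc c k j with k ≡ᵇ j
  ... | true  = refl
  ... | false = refl

  mono-⊛ : ∀ c k f n → (mono c k ⊛ f) n ≡ c * shift k f n
  mono-⊛ c zero    f zero    = refl
  mono-⊛ c (suc k) f zero    = sym (*-zeroʳ c)
  mono-⊛ c zero    f (suc n) = begin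
    (mono c 0 ⊛ f) (suc n)                         ≡⟨ sumTo-suc n _ ⟩
    c * f (suc n) + sumTo n (const (+ 0))          ≡⟨ cong (_+_ (c * f (suc n))) (sumTo-zeros n) ⟩
    c * f (suc n) + + 0                            ≡⟨ +-identityʳ _ ⟩
    c * f (suc n)                                  ∎
  mono-⊛ c (suc k) f (suc n) = begin
    (mono c (suc k) ⊛ f) (suc n)                   ≡⟨ sumTo-suc n _ ⟩
    + 0 + sumTo n (λ i → mono c (suc k) (suc i) * f (n ∸ i)) ≡⟨ +-identityˡ _ ⟩
    sumTo n (λ i → mono c (suc k) (suc i) * f (n ∸ i))       ≡⟨ ⊛-congˡ f n (mono-suc c k) ⟩
    (mono c k ⊛ f) n                               ≡⟨ mono-⊛ c k f n ⟩
    c * shift k f n                                ∎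

  shift-⊛ : ∀ k f g n → (shift k f ⊛ g) n ≡ shift k (f ⊛ g) n
  shift-⊛ zero    f g n       = refl
  shift-⊛ (suc k) f g zero    = refl
  shift-⊛ (suc k) f g (suc n) = trans (sumTo-suc n _) (trans (+-identityˡ _) (shift-⊛ k f g n))

  mono-⊛-⊛ : ∀ c k f g n → ((mono c k ⊛ f) ⊛ g) n ≡ c * shift k (f ⊛ g) n
  mono-⊛-⊛ c k f g n = begin
    ((mono c k ⊛ f) ⊛ g) n               ≡⟨ ⊛-congˡ g n (mono-⊛ c k f) ⟩
    ((λ i → c * shift k f i) ⊛ g) n      ≡⟨ ⊛-scaleˡ c (shift k f) g n ⟩
    c * (shift k f ⊛ g) n                ≡⟨ cong (c *_) (shift-⊛ k f g n) ⟩
    c * shift k (f ⊛ g) n                ∎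

  four-monomials-⊛ : ∀ a i b j c k e l f n →
    ((mono a i ⊕ (mono b j ⊕ (mono c k ⊕ mono e l))) ⊛ f) n
      ≡ a * shift i f n + (b * shift j f n + (c * shift k f n + e * shift l f n))
  four-monomials-⊛ a i b j c k e l f n =
    trans (⊛-distribʳ-⊕ (mono a i) _ f n) (cong₂ _+_ (mono-⊛ a i f n)
      (trans (⊛-distribʳ-⊕ (mono b j) _ f n) (cong₂ _+_ (mono-⊛ b j f n)
        (trans (⊛-distribʳ-⊕ (mono c k) (mono e l) f n) (cong₂ _+_ (mono-⊛ c k f n) (mono-⊛ e l f n))))))

  sumTo≡⊛𝟙 : ∀ f n → sumTo n f ≡ (f ⊛ 𝟙) n
  sumTo≡⊛𝟙 f n = sumTo-cong n (λ i → sym (*-identityʳ (f i)))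

  ∇-cong : ∀ {f g} → (∀ n → f n ≡ g n) → ∀ n → ∇ f n ≡ ∇ g n
  ∇-cong f≡g zero    = cong (_- + 0) (f≡g 0)
  ∇-cong f≡g (suc n) = cong₂ _-_ (f≡g (suc n)) (f≡g n)

  ∇-sumTo : ∀ f n → ∇ (λ k → sumTo k f) n ≡ f n
  ∇-sumTo f zero    = +-identityʳ (f 0)
  ∇-sumTo f (suc n) = cancel (sumTo n f) (f (suc n))
    where
    cancel : ∀ a b → a + b - a ≡ b
    cancel = solve-∀

  shift-defect : ∀ f k n → f (n ∸ k) - shift k f n ≡ f 0 - shift k (const (f 0)) n
  shift-defect f zero    n       = trans (+-inverseʳ (f n)) (sym (+-inverseʳ (f 0)))
  shift-defect f (suc k) zero    = refl
  shift-defect f (suc k) (suc n) = shift-defect f k n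

  denomFactor : ℕ → Series
  denomFactor d = mono (+ 1) 0 ⊕ (mono (- + 2) 1 ⊕ (mono (+ 1) 2 ⊕ mono (- + 1) (suc d)))

  denom-⊛ : ∀ d f n → (denom d ⊛ f) n ≡ ∇ (denomFactor d ⊛ f) n
  denom-⊛ d f n = begin
    (denom d ⊛ f) n
      ≡⟨ ⊛-congˡ f n (⊛-distribʳ-⊕ (mono (+ 1) 0) (mono (- + 1) 1) B) ⟩
    (((mono (+ 1) 0 ⊛ B) ⊕ (mono (- + 1) 1 ⊛ B)) ⊛ f) n
      ≡⟨ ⊛-distribʳ-⊕ (mono (+ 1) 0 ⊛ B) (mono (- + 1) 1 ⊛ B) f n ⟩
    ((mono (+ 1) 0 ⊛ B) ⊛ f) n + ((mono (- + 1) 1 ⊛ B) ⊛ f) n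
      ≡⟨ cong₂ _+_ (mono-⊛-⊛ (+ 1) 0 B f n) (mono-⊛-⊛ (- + 1) 1 B f n) ⟩
    + 1 * (B ⊛ f) n + - + 1 * shift 1 (B ⊛ f) n
      ≡⟨ difference ((B ⊛ f) n) (shift 1 (B ⊛ f) n) ⟩
    ∇ (B ⊛ f) n ∎
    where
    B = denomFactor d
    difference : ∀ a b → + 1 * a + - + 1 * b ≡ a - b
    difference = solve-∀

  genfun-recurrence : ∀ d m →
    genfun d (suc (suc m)) + genfun d m ≡ genfun d (suc m) + genfun d (suc m) + genfun d (suc m ∸ d)
  genfun-recurrence d m = begin
    + v d (suc (suc m)) + + v d m                      ≡⟨ sym (pos-+ (v d (suc (suc m))) (v d m)) ⟩
    + (v d (suc (suc m)) ℕ.+ v d m)             ≡⟨ cong +_ (v-recurrence d m) ⟩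
    + (v d (suc m) ℕ.+ v d (suc m) ℕ.+ v d (suc m ∸ d))
      ≡⟨ pos-+ (v d (suc m) ℕ.+ v d (suc m)) (v d (suc m ∸ d)) ⟩
    + (v d (suc m) ℕ.+ v d (suc m)) + + v d (suc m ∸ d)
      ≡⟨ cong (_+ + v d (suc m ∸ d)) (pos-+ (v d (suc m)) (v d (suc m))) ⟩
    + v d (suc m) + + v d (suc m) + + v d (suc m ∸ d) ∎

  second-difference : ∀ a b c e s → a + c ≡ b + b + e →
    + 1 * a + (- + 2 * b + (+ 1 * c + - + 1 * s)) ≡ e - s
  second-difference a b c e s a+c≡2b+e = begin
    + 1 * a + (- + 2 * b + (+ 1 * c + - + 1 * s)) ≡⟨ regroup a b c s ⟩
    a + c - (b + b) - s                           ≡⟨ cong (λ x → x - (b + b) - s) a+c≡2b+e ⟩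
    b + b + e - (b + b) - s                       ≡⟨ cancel (b + b) e s ⟩
    e - s                                         ∎
    where
    regroup : ∀ a b c s → + 1 * a + (- + 2 * b + (+ 1 * c + - + 1 * s)) ≡ a + c - (b + b) - s
    regroup = solve-∀
    cancel : ∀ x e s → x + e - x - s ≡ e - s
    cancel = solve-∀

  denomFactor-⊛-genfun : ∀ d n → (denomFactor d ⊛ genfun d) n ≡ sumTo n (numer d)
  denomFactor-⊛-genfun d       zero          = refl
  denomFactor-⊛-genfun zero    (suc zero)    = refl
  denomFactor-⊛-genfun (suc d) (suc zero)    = refl
  denomFactor-⊛-genfun d       (suc (suc m)) = begin
    (denomFactor d ⊛ g) (suc (suc m))
      ≡⟨ four-monomials-⊛ (+ 1) 0 (- + 2) 1 (+ 1) 2 (- + 1) (suc d) g (suc (suc m)) ⟩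
    + 1 * g (suc (suc m)) + (- + 2 * g (suc m) + (+ 1 * g m + - + 1 * shift d g (suc m)))
      ≡⟨ second-difference (g (suc (suc m))) (g (suc m)) (g m) (g (suc m ∸ d)) (shift d g (suc m)) (genfun-recurrence d m) ⟩
    g (suc m ∸ d) - shift d g (suc m)
      ≡⟨ shift-defect g d (suc m) ⟩
    + 1 - shift d 𝟙 (suc m)
      ≡⟨ expand (shift d 𝟙 (suc m)) ⟩
    + 1 * + 1 + (- + 2 * + 1 + (+ 2 * + 1 + - + 1 * shift d 𝟙 (suc m)))
      ≡⟨ sym (four-monomials-⊛ (+ 1) 0 (- + 2) 1 (+ 2) 2 (- + 1) (suc d) 𝟙 (suc (suc m))) ⟩
    (numer d ⊛ 𝟙) (suc (suc m))
      ≡⟨ sym (sumTo≡⊛𝟙 (numer d) (suc (suc m))) ⟩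
    sumTo (suc (suc m)) (numer d) ∎
    where
    g = genfun d
    expand : ∀ s → + 1 - s ≡ + 1 * + 1 + (- + 2 * + 1 + (+ 2 * + 1 + - + 1 * s))
    expand = solve-∀

open PowerSeries using (∇; denomFactor; denom-⊛; ∇-cong; denomFactor-⊛-genfun; ∇-sumTo)

mainTheorem2 : (d : ℕ) → (n : ℕ) → (denom d ⊛ genfun d) n ≡ numer d n
mainTheorem2 d n = begin
  (denom d ⊛ genfun d) n              ≡⟨ denom-⊛ d (genfun d) n ⟩
  ∇ (denomFactor d ⊛ genfun d) n      ≡⟨ ∇-cong (denomFactor-⊛-genfun d) n ⟩
  ∇ (λ k → sumTo k (numer d)) n       ≡⟨ ∇-sumTo (numer d) n ⟩
  numer d n                           ∎
  where open ≡-Reasoning
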